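{- Let $\varphi(x;\overline{y})$ be a partitioned formula with $x$ a single variable, and let $K<\omega$ be such that for every sequence $\langle\overline{b}_i:i<K\rangle$ of $\mathrm{lg}(\overline{y})$-tuples from $\mathfrak{C}$: (a) there exist $\ell<k<K$ with $\models\neg\exists x\big(\varphi(x;\overline{b}_k)\wedge\varphi(x;\overline{b}_\ell)\wedge\bigwedge_{i<k,\,i\neq\ell}\neg\varphi(x;\overline{b}_i)\big)$, and (b) there exist $\ell<k<K$ with $\models\neg\exists x\big(\neg\varphi(x;\overline{b}_k)\wedge\neg\varphi(x;\overline{b}_\ell)\wedge\bigwedge_{i<k,\,i\neq\ell}\varphi(x;\overline{b}_i)\big)$. Then for every finite $B\subseteq\mathfrak{C}^{\mathrm{lg}(\overline{y})}$ and every $p\in S_\varphi(B)$, the set $\mathcal{B}_{2K-1}$ defined from $B$ and $p$ is empty.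
   Context: Work in a monster model $\mathfrak{C}$ of a complete theory $T$. $\theta^1=\theta$, $\theta^0=\neg\theta$. For $p\in S_\varphi(B)$ (a maximal consistent set of formulas $\varphi(x;\overline{b})^t$, $\overline{b}\in B$, $t<2$) let $\delta:B\to 2$ be such that $\varphi(x;\overline{b})^{\delta(\overline{b})}\in p$. For $B_1\subseteq B_0\subseteq B$: $p_{B_0}=\{\varphi(x;\overline{b})^{\delta(\overline{b})}:\overline{b}\in B_0\}$ and $p_{B_0,B_1}=\{\varphi(x;\overline{b})^{\delta(\overline{b})}:\overline{b}\in B_0-B_1\}\cup\{\neg\varphi(x;\overline{b})^{\delta(\overline{b})}:\overline{b}\in B_1\}$; for finite sequences from $B$ these notations are applied to the sets of their entries. A set of formulas $q(x)$ decides $\varphi(x;\overline{b})$ if $q\vdash\varphi(x;\overline{b})$ or $q\vdash\neg\varphi(x;\overline{b})$. A set (or sequence) $B_0\subseteq B$ $*$-decides $\varphi(x;\overline{b})$ if $p_{B_0}$ decides $\varphi(x;\overline{b})$ or there is $\overline{b}'\in B_0$ such that $p_{B_0,\{\overline{b}'\}}$ is consistent and decides $\varphi(x;\overline{b})$. Define $\mathcal{B}_1=\{\langle\overline{b}\rangle:\overline{b}\in B,\ \varphi(x;\overline{b}) \text{ and } \neg\varphi(x;\overline{b})\text{ are both consistent}\}$ and, for $n>1$, $\mathcal{B}_n=\{\beta^\frown\langle\overline{b}\rangle:\overline{b}\in B,\ \beta\in\mathcal{B}_{n-1},\ \beta\text{ does not }*\text{ -decide }\varphi(x;\overline{b})\}$.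 -}

module Defs where

open import Data.Nat using (ℕ; zero; suc)
open import Data.Bool using (Bool; true; false; not)
open import Data.Fin using (Fin) renaming (_<_ to _<ᶠ_)
open import Data.List using (List; []; _∷_; _++_; [_])
open import Data.List.Membership.Propositional using (_∈_)
open import Data.Product using (Σ; _×_; ∃)
open import Data.Sum using (_⊎_)
open import Relation.Nullary using (¬_)
open import Relation.Binary.PropositionalEquality using (_≡_)

-- Semantic setting: M is the universe of the monster model, Y the set of
-- lg(ȳ)-tuples, and φ a : Y → Bool gives the truth value of φ(a; b̄).
-- A literal φ(x;b̄)^t is the pair (b̄ , t); a set of literals is a
-- predicate  Y → Bool → Set.
module _ {M Y : Set} (φ : M → Y → Bool) where

  Lits : Set₁
  Lits = Y → Bool → Set

  Sat : M → Lits → Set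
  Sat a q = ∀ b t → q b t → φ a b ≡ t

  Consistent : Lits → Set
  Consistent q = Σ M λ a → Sat a q

  Entails : Lits → Y → Bool → Set
  Entails q b t = ∀ a → Sat a q → φ a b ≡ t

  Decides : Lits → Y → Set
  Decides q b = Entails q b true ⊎ Entails q b false

  -- p ∈ S_φ(B), given by δ : B → 2 such that {φ(x;b)^{δ b} : b ∈ B} is consistent
  -- (values of δ outside B are irrelevant)
  IsType : List Y → (Y → Bool) → Set
  IsType B δ = Consistent (λ b t → b ∈ B × t ≡ δ b)

  module _ (δ : Y → Bool) where

    pB : List Y → Lits
    pB β b t = b ∈ β × t ≡ δ b

    pBB : List Y → Y → Lits
    pBB β b' b t = b ∈ β × (b ≡ b' → t ≡ not (δ b)) × (¬ b ≡ b' → t ≡ δ b)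

    StarDecides : List Y → Y → Set
    StarDecides β b =
      Decides (pB β) b ⊎
      Σ Y λ b' → b' ∈ β × Consistent (pBB β b') × Decides (pBB β b') b

    data InB (B : List Y) : ℕ → List Y → Set where
      base : ∀ {b} → b ∈ B
           → Consistent (λ c t → c ≡ b × t ≡ true)
           → Consistent (λ c t → c ≡ b × t ≡ false)
           → InB B 1 [ b ]
      step : ∀ {n β b} → b ∈ B → InB B (suc n) β → ¬ StarDecides β b
           → InB B (suc (suc n)) (β ++ [ b ])

  CondA : ℕ → Set
  CondA K = (bs : Fin K → Y) → Σ (Fin K) λ ℓ → Σ (Fin K) λ k → ℓ <ᶠ k ×
    ¬ (Σ M λ a → φ a (bs k) ≡ true × φ a (bs ℓ) ≡ true ×
        (∀ i → i <ᶠ k → ¬ i ≡ ℓ → φ a (bs i) ≡ false))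

  CondB : ℕ → Set
  CondB K = (bs : Fin K → Y) → Σ (Fin K) λ ℓ → Σ (Fin K) λ k → ℓ <ᶠ k ×
    ¬ (Σ M λ a → φ a (bs k) ≡ false × φ a (bs ℓ) ≡ false ×
        (∀ i → i <ᶠ k → ¬ i ≡ ℓ → φ a (bs i) ≡ true))

-- Split β ∈ 𝓑ₙ into the subsequence γᵗ of entries b̄ with δ(b̄) = t, for t = true and
-- t = false. Because β never *-decides its next entry b̄, the type p_{β,{b̄′}} stays
-- consistent for every b̄′ ∈ β and remains consistent with φ(x;b̄)^s for both values s.
-- Taking b̄′ = γᵗ_ℓ and s = ¬t for a later entry b̄ = γᵗ_k realizes exactly the
-- configuration that (b) (for t = true) or (a) (for t = false) excludes. Hence both
-- subsequences have length below K, so lg β ≤ 2K − 2.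
module Submission where

open import Defs
open import Data.Nat using (ℕ; zero; suc; _+_; _*_; _∸_; _≤_; s≤s; s≤s⁻¹)
  renaming (_<_ to _<ℕ_)
open import Data.Nat.Properties
  using (≤-trans; +-suc; +-mono-≤; +-monoʳ-<; +-identityʳ; n<1+n; ∸-monoʳ-<; ≰⇒>; <⇒≢; module ≤-Reasoning)
open import Data.Bool using (Bool; true; false; not)
open import Data.Bool.Properties using (¬-not)
open import Data.Fin using (Fin; zero; suc; toℕ; _<_; inject≤; opposite)
open import Data.Fin.Properties
  using (toℕ<n; toℕ-inject≤; inject≤-injective; opposite-prop; opposite-involutive)
open import Data.Vec.Functional using (Vector; _∷_)
open import Data.List using (List; []; _++_; [_])
open import Data.List.Membership.Propositional using (_∈_; _∉_)
open import Data.List.Membership.Propositional.Properties using (∈-++⁻; ∈-++⁺ˡ; ∈-++⁺ʳ)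
open import Data.List.Relation.Unary.Any using (here)
open import Data.Product using (Σ; _×_; _,_)
open import Data.Sum using (inj₁; inj₂)
open import Function using (_∘_)
open import Effect.Monad using (RawMonad)
open import Level using (0ℓ)
open import Relation.Nullary using (¬_; contradiction)
open import Relation.Nullary.Negation using (¬¬-Monad)
open import Relation.Binary.PropositionalEquality
  using (_≡_; _≢_; refl; sym; trans; cong; subst; module ≡-Reasoning)

open RawMonad (¬¬-Monad {0ℓ}) using (pure; _>>=_)

<∧<⇒+<2*∸1 : ∀ {m n K} → m <ℕ K → n <ℕ K → m + n <ℕ 2 * K ∸ 1
<∧<⇒+<2*∸1 {m} {n} {suc K} m<K n<K = begin-strict
  m + n            ≤⟨ +-mono-≤ (s≤s⁻¹ m<K) (s≤s⁻¹ n<K) ⟩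
  K + K            <⟨ +-monoʳ-< K (n<1+n K) ⟩
  K + suc K        ≡⟨ cong (K +_) (+-identityʳ (suc K)) ⟨
  K + (suc K + 0)  ∎
  where open ≤-Reasoning

module _ {m K : ℕ} (K≤m : K ≤ m) where

  reverseEmbedding : Fin K → Fin m
  reverseEmbedding i = opposite (inject≤ i K≤m)

  reverseEmbedding-antitone : ∀ {i j} → i < j → reverseEmbedding j < reverseEmbedding i
  reverseEmbedding-antitone {i} {j} i<j = begin-strict
    toℕ (reverseEmbedding j)       ≡⟨ opposite-prop (inject≤ j K≤m) ⟩
    m ∸ suc (toℕ (inject≤ j K≤m))  ≡⟨ cong (λ x → m ∸ suc x) (toℕ-inject≤ j K≤m) ⟩
    m ∸ suc (toℕ j)                <⟨ ∸-monoʳ-< (s≤s i<j) (≤-trans (toℕ<n j) K≤m) ⟩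
    m ∸ suc (toℕ i)                ≡⟨ cong (λ x → m ∸ suc x) (toℕ-inject≤ i K≤m) ⟨
    m ∸ suc (toℕ (inject≤ i K≤m))  ≡⟨ opposite-prop (inject≤ i K≤m) ⟨
    toℕ (reverseEmbedding i)       ∎
    where open ≤-Reasoning

  reverseEmbedding-injective : ∀ {i j} → reverseEmbedding i ≡ reverseEmbedding j → i ≡ j
  reverseEmbedding-injective {i} {j} eq = inject≤-injective K≤m K≤m i j (begin
    inject≤ i K≤m                  ≡⟨ opposite-involutive (inject≤ i K≤m) ⟨
    opposite (reverseEmbedding i)  ≡⟨ cong opposite eq ⟩
    opposite (reverseEmbedding j)  ≡⟨ opposite-involutive (inject≤ j K≤m) ⟩
    inject≤ j K≤m                  ∎)
    where open ≡-Reasoning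

module _ {M Y : Set} (φ : M → Y → Bool) where

  entails⇒decides : ∀ {q b} t → Entails φ q b t → Decides φ q b
  entails⇒decides true  = inj₁
  entails⇒decides false = inj₂

  ¬decides⇒realizable : ∀ {q b} → ¬ Decides φ q b →
                        ∀ t → ¬ ¬ (Σ M λ a → Sat φ a q × φ a b ≡ t)
  ¬decides⇒realizable undecided t unrealizable =
    undecided (entails⇒decides (not t) λ a sat →
      ¬-not λ φab≡t → unrealizable (a , sat , φab≡t))

  -- The configuration forbidden by hypothesis (b) for t = true, and by (a) for t = false.
  Configuration : ∀ {n} → Bool → Vector Y n → Fin n → Fin n → Set
  Configuration t bs k ℓ = Σ M λ a → φ a (bs k) ≡ not t × φ a (bs ℓ) ≡ not t ×
                             (∀ i → i < k → i ≢ ℓ → φ a (bs i) ≡ t)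

  Forbidden : Bool → ℕ → Set
  Forbidden t K = (bs : Vector Y K) → Σ (Fin K) λ ℓ → Σ (Fin K) λ k → ℓ < k ×
                    ¬ Configuration t bs k ℓ

  -- Sequences are stored newest entry first, so "earlier" means "at a larger index".
  ReverseConfiguration : ∀ {n} → Bool → Vector Y n → Fin n → Fin n → Set
  ReverseConfiguration t γ k ℓ = Σ M λ a → φ a (γ k) ≡ not t × φ a (γ ℓ) ≡ not t ×
                                   (∀ i → k < i → i ≢ ℓ → φ a (γ i) ≡ t)

  reverseConfiguration⇒configuration :
    ∀ {n K t} {γ : Vector Y n} {f : Fin K → Fin n} →
    (∀ {i j} → i < j → f j < f i) → (∀ {i j} → f i ≡ f j → i ≡ j) →
    ∀ {k ℓ} → ReverseConfiguration t γ (f k) (f ℓ) → Configuration t (γ ∘ f) k ℓ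
  reverseConfiguration⇒configuration {f = f} antitone injective (a , φk , φℓ , others) =
    a , φk , φℓ , λ i i<k i≢ℓ → others (f i) (antitone i<k) (i≢ℓ ∘ injective)

  record Pattern (t : Bool) {n : ℕ} (γ : Vector Y n) : Set where
    field
      injective      : ∀ {i j} → γ i ≡ γ j → i ≡ j
      configurations : ∀ {k ℓ} → k < ℓ → ¬ ¬ ReverseConfiguration t γ k ℓ

  open Pattern

  pattern-[] : ∀ {t} → Pattern t {0} (λ ())
  pattern-[] = record { injective = λ { {()} } ; configurations = λ { {()} } }

  pattern-∷ : ∀ {t n b} {γ : Vector Y n} → Pattern t γ → (∀ i → γ i ≢ b) →
              (∀ ℓ → ¬ ¬ (Σ M λ a → φ a b ≡ not t × φ a (γ ℓ) ≡ not t ×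
                                      (∀ i → i ≢ ℓ → φ a (γ i) ≡ t))) →
              Pattern t (b ∷ γ)
  pattern-∷ {t} {_} {b} {γ} P fresh newest = record { injective = inj ; configurations = conf }
    where
    inj : ∀ {i j} → (b ∷ γ) i ≡ (b ∷ γ) j → i ≡ j
    inj {zero}  {zero}  _ = refl
    inj {zero}  {suc j} e = contradiction (sym e) (fresh j)
    inj {suc i} {zero}  e = contradiction e (fresh i)
    inj {suc i} {suc j} e = cong suc (injective P e)

    conf : ∀ {k ℓ} → k < ℓ → ¬ ¬ ReverseConfiguration t (b ∷ γ) k ℓ
    conf {zero} {suc ℓ} _ = do
      (a , φb , φℓ , others) ← newest ℓ
      pure (a , φb , φℓ , λ { (suc i) _ i≢ℓ → others i (i≢ℓ ∘ cong suc) })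
    conf {suc k} {suc ℓ} (s≤s k<ℓ) = do
      (a , φk , φℓ , others) ← configurations P k<ℓ
      pure (a , φk , φℓ , λ { (suc i) (s≤s k<i) i≢ℓ → others i k<i (i≢ℓ ∘ cong suc) })

  pattern-shorter : ∀ {t n K} {γ : Vector Y n} → Forbidden t K → Pattern t γ → n <ℕ K
  pattern-shorter {γ = γ} forbidden P = ≰⇒> λ K≤n →
    let (ℓ , k , ℓ<k , unrealizable) = forbidden (γ ∘ reverseEmbedding K≤n) in
    configurations P (reverseEmbedding-antitone K≤n ℓ<k)
      (unrealizable ∘ reverseConfiguration⇒configuration
        (reverseEmbedding-antitone K≤n) (reverseEmbedding-injective K≤n))

  module _ (δ : Y → Bool) where

    ¬starDecides⇒∉ : ∀ {β b} → ¬ StarDecides φ δ β b → b ∉ β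
    ¬starDecides⇒∉ {b = b} undecided b∈β =
      undecided (inj₁ (entails⇒decides (δ b) λ a sat → sat b (δ b) (b∈β , refl)))

    ¬starDecides-[] : ∀ {b} → Consistent φ (λ c t → c ≡ b × t ≡ true) →
                      Consistent φ (λ c t → c ≡ b × t ≡ false) → ¬ StarDecides φ δ [] b
    ¬starDecides-[] {b} _ (a₀ , sat₀) (inj₁ (inj₁ ⊢φ))
      with () ← trans (sym (⊢φ a₀ λ _ _ ())) (sat₀ b false (refl , refl))
    ¬starDecides-[] {b} (a₁ , sat₁) _ (inj₁ (inj₂ ⊢¬φ))
      with () ← trans (sym (⊢¬φ a₁ λ _ _ ())) (sat₁ b true (refl , refl))
    ¬starDecides-[] _ _ (inj₂ (_ , () , _))

    pBB-flips : ∀ {a β b′} → Sat φ a (pBB φ δ β b′) → b′ ∈ β → φ a b′ ≡ not (δ b′)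
    pBB-flips sat b′∈β = sat _ _ (b′∈β , (λ _ → refl) , λ b′≢b′ → contradiction refl b′≢b′)

    pBB-agrees : ∀ {a β b′ c} → Sat φ a (pBB φ δ β b′) → c ∈ β → c ≢ b′ → φ a c ≡ δ c
    pBB-agrees sat c∈β c≢b′ = sat _ _ (c∈β , (λ c≡b′ → contradiction c≡b′ c≢b′) , λ _ → refl)

    pBB-∷ʳ : ∀ {a β b b′} → Sat φ a (pBB φ δ β b′) → φ a b ≡ δ b → b ≢ b′ →
             Sat φ a (pBB φ δ (β ++ [ b ]) b′)
    pBB-∷ʳ {β = β} sat φb b≢b′ c t (c∈ , flipped , kept) with ∈-++⁻ β c∈
    ... | inj₁ c∈β        = sat c t (c∈β , flipped , kept)
    ... | inj₂ (here refl) = trans φb (sym (kept b≢b′))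

    pBB-∷ʳ-flipped : ∀ {a β b} → Sat φ a (pB φ δ β) → φ a b ≡ not (δ b) → b ∉ β →
                     Sat φ a (pBB φ δ (β ++ [ b ]) b)
    pBB-∷ʳ-flipped {β = β} sat φb b∉β c t (c∈ , flipped , kept) with ∈-++⁻ β c∈
    ... | inj₁ c∈β        = trans (sat c (δ c) (c∈β , refl))
                                   (sym (kept λ { refl → b∉β c∈β }))
    ... | inj₂ (here refl) = trans φb (sym (flipped refl))

    FlipConsistent : List Y → Set
    FlipConsistent β = ∀ {b′} → b′ ∈ β → ¬ ¬ Consistent φ (pBB φ δ β b′)

    flipConsistent-∷ʳ : ∀ {β b} → FlipConsistent β → ¬ StarDecides φ δ β b →
                        FlipConsistent (β ++ [ b ])
    flipConsistent-∷ʳ {β} {b} consistent undecided {b′} b′∈ with ∈-++⁻ β b′∈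
    ... | inj₁ b′∈β = do
      flipConsistent ← consistent b′∈β
      (a , sat , φb) ← ¬decides⇒realizable
        (λ decides → undecided (inj₂ (b′ , b′∈β , flipConsistent , decides))) (δ b)
      pure (a , pBB-∷ʳ sat φb λ { refl → ¬starDecides⇒∉ undecided b′∈β })
    ... | inj₂ (here refl) = do
      (a , sat , φb) ← ¬decides⇒realizable (undecided ∘ inj₁) (not (δ b))
      pure (a , pBB-∷ʳ-flipped sat φb (¬starDecides⇒∉ undecided))

    -- 𝓑₁ is the case β = [] of the recursion defining 𝓑ₙ₊₁.
    inB⇒flipConsistent : ∀ {B n β} → InB φ δ B n β → FlipConsistent β
    inB⇒flipConsistent (base _ c₁ c₀) = flipConsistent-∷ʳ (λ ()) (¬starDecides-[] c₁ c₀)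
    inB⇒flipConsistent (step _ ib undecided) =
      flipConsistent-∷ʳ (inB⇒flipConsistent ib) undecided

    record Part (β : List Y) (t : Bool) : Set where
      field
        size      : ℕ
        seq       : Vector Y size
        isPattern : Pattern t seq
        seq∈β     : ∀ i → seq i ∈ β
        δ-seq     : ∀ i → δ (seq i) ≡ t

    open Part

    part-[] : ∀ {t} → Part [] t
    part-[] = record { size = 0 ; seq = λ () ; isPattern = pattern-[] ; seq∈β = λ () ; δ-seq = λ () }

    part-weaken : ∀ {β b t} → Part β t → Part (β ++ [ b ]) t
    part-weaken P = record
      { size = size P ; seq = seq P ; isPattern = isPattern P
      ; seq∈β = ∈-++⁺ˡ ∘ seq∈β P ; δ-seq = δ-seq P }

    part-∷ʳ : ∀ {β b t} → FlipConsistent β → ¬ StarDecides φ δ β b → δ b ≡ t →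
              Part β t → Part (β ++ [ b ]) t
    part-∷ʳ {β} {b} {t} consistent undecided δb P = record
      { size      = suc (size P)
      ; seq       = b ∷ γ
      ; isPattern = pattern-∷ (isPattern P)
                      (λ i γi≡b → b∉β (subst (_∈ β) γi≡b (seq∈β P i))) newest
      ; seq∈β     = λ { zero → ∈-++⁺ʳ β (here refl) ; (suc i) → ∈-++⁺ˡ (seq∈β P i) }
      ; δ-seq     = λ { zero → δb ; (suc i) → δ-seq P i }
      }
      where
      γ = seq P
      b∉β = ¬starDecides⇒∉ undecided

      newest : ∀ ℓ → ¬ ¬ (Σ M λ a → φ a b ≡ not t × φ a (γ ℓ) ≡ not t ×
                                     (∀ i → i ≢ ℓ → φ a (γ i) ≡ t))
      newest ℓ = do
        flipConsistent ← consistent (seq∈β P ℓ)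
        (a , sat , φb) ← ¬decides⇒realizable
          (λ decides → undecided (inj₂ (γ ℓ , seq∈β P ℓ , flipConsistent , decides))) (not t)
        pure (a , φb , trans (pBB-flips sat (seq∈β P ℓ)) (cong not (δ-seq P ℓ))
                , λ i i≢ℓ → trans (pBB-agrees sat (seq∈β P i) (i≢ℓ ∘ injective (isPattern P)))
                                  (δ-seq P i))

    record Partition (β : List Y) (n : ℕ) : Set where
      field
        trues    : Part β true
        falses   : Part β false
        size-sum : size trues + size falses ≡ n

    open Partition

    partition-∷ʳ : ∀ {β b n} → FlipConsistent β → ¬ StarDecides φ δ β b →
                   Partition β n → Partition (β ++ [ b ]) (suc n)
    partition-∷ʳ {b = b} consistent undecided P with δ b in δb
    ... | true  = record { trues  = part-∷ʳ consistent undecided δb (trues P)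
                         ; falses = part-weaken (falses P)
                         ; size-sum = cong suc (size-sum P) }
    ... | false = record { trues  = part-weaken (trues P)
                         ; falses = part-∷ʳ consistent undecided δb (falses P)
                         ; size-sum = trans (+-suc (size (trues P)) _) (cong suc (size-sum P)) }

    inB⇒partition : ∀ {B n β} → InB φ δ B n β → Partition β n
    inB⇒partition (base _ c₁ c₀) =
      partition-∷ʳ (λ ()) (¬starDecides-[] c₁ c₀)
        (record { trues = part-[] ; falses = part-[] ; size-sum = refl })
    inB⇒partition (step _ ib undecided) =
      partition-∷ʳ (inB⇒flipConsistent ib) undecided (inB⇒partition ib)

lemma3p12 : {M Y : Set} (φ : M → Y → Bool) (K : ℕ)
    → CondA φ K → CondB φ K
    → (B : List Y) (δ : Y → Bool) → IsType φ B δ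
    → (β : List Y) → ¬ InB φ δ B (2 * K ∸ 1) β
lemma3p12 φ K condA condB B δ _ β ib =
  <⇒≢ (<∧<⇒+<2*∸1 (pattern-shorter φ condB (Part.isPattern trues))
                   (pattern-shorter φ condA (Part.isPattern falses)))
      size-sum
  where open Partition (inB⇒partition φ δ ib)
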